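{- Let $p,q$ be positive integers with $2\le p/q<4$ and let $f$ be a $(p,q)$-colouring of a graph $G$. Suppose $v$ lies on a directed cycle of $D_f$ (equivalently, $v$ belongs to a nontrivial strongly connected component of $D_f$). Then $h(v)=f(v)$ for every $(p,q)$-colouring $h$ of $G$ to which $f$ reconfigures; that is, the colour of $v$ cannot be changed under any sequence of recolourings.
   Context: A $(p,q)$-colouring of $G$ is a map $f:V(G)\to\{0,\dots,p-1\}$ with $q\le|f(u)-f(v)|\le p-q$ for every edge $uv$. $f$ reconfigures to $h$ if there is a sequence $f=f_0,\dots,f_n=h$ of $(p,q)$-colourings of $G$ with consecutive colourings differing on only one vertex. $D_f$ is the digraph on $V(G)$ with an arc from $x$ to $y$ whenever $xy\in E(G)$ and $f(y)-f(x)\equiv q\pmod p$. -}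

module Defs where

open import Data.Nat using (ℕ; _≤_; _<_; _∸_; _*_; ∣_-_∣)
open import Data.Fin using (Fin)
open import Data.Integer using (ℤ; +_; _-_)
open import Data.Integer.Divisibility using (_∣_)
open import Data.Product using (_×_; ∃-syntax)
open import Relation.Nullary using (¬_)
open import Relation.Binary.PropositionalEquality using (_≡_)
open import Relation.Binary.Construct.Closure.ReflexiveTransitive using (Star)
open import Relation.Binary.Construct.Closure.Transitive using (TransClosure)

record Graph : Set₁ where
  field
    n     : ℕ
    Adj   : Fin n → Fin n → Set
    sym   : ∀ {x y} → Adj x y → Adj y x
    irrefl : ∀ {x} → ¬ Adj x x
open Graph public

Colouring : Graph → Set
Colouring G = Fin (n G) → ℕ

IsColouring : (p q : ℕ) (G : Graph) → Colouring G → Set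
IsColouring p q G f =
  (∀ v → f v < p) ×
  (∀ u v → Adj G u v → (q ≤ ∣ f u - f v ∣) × (∣ f u - f v ∣ ≤ p ∸ q))

Step : (p q : ℕ) (G : Graph) → Colouring G → Colouring G → Set
Step p q G f g =
  IsColouring p q G f × IsColouring p q G g ×
  (∃[ v ] (∀ u → ¬ (u ≡ v) → f u ≡ g u))

Reconfigures : (p q : ℕ) (G : Graph) → Colouring G → Colouring G → Set
Reconfigures p q G = Star (Step p q G)

Arc : (p q : ℕ) (G : Graph) → Colouring G → Fin (n G) → Fin (n G) → Set
Arc p q G f x y = Adj G x y × ((+ p) ∣ ((+ f y - + f x) - + q))

-- v lies on a directed cycle of D_f: a nonempty closed directed walk from v to v.
OnDirectedCycle : (p q : ℕ) (G : Graph) → Colouring G → Fin (n G) → Set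
OnDirectedCycle p q G f v = TransClosure (Arc p q G f) v v

-- Along an arc of D_f the colour increases by exactly q modulo p.  So for a path
-- w → x → y in D_f we have f(x) ≡ f(w) + q and f(y) ≡ f(w) + 2q, and a recolouring
-- of x alone must keep it at cyclic distance at least q from f(w) and from f(y).
-- The two open arcs of radius q around f(w) and f(w) + 2q have total length 4q > p,
-- so together they cover every residue except f(w) + q = f(x): a single recolouring
-- cannot move a vertex with both an in-arc and an out-arc.  Hence it fixes every
-- vertex of a directed cycle, the cycle survives into the new colouring, and
-- induction along the reconfiguration sequence concludes.
module Submission where

open import Defs hiding (sym)
open import Data.Nat
open import Data.Nat.Properties
open import Data.Nat.Tactic.RingSolver using (solve)
open import Data.Fin using (Fin) renaming (_≟_ to _≟ᶠ_)
open import Data.Integer as ℤ using (_⊖_)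
import Data.Integer.Properties as ℤ
open import Data.Integer.Divisibility using (_∣_; divides)
open import Data.List using (_∷_; [])
open import Data.Product using (_×_; _,_; proj₁; proj₂; ∃)
open import Data.Sum using (_⊎_; inj₁; inj₂)
import Data.Sum as Sum
open import Data.Empty using (⊥-elim)
open import Relation.Binary.Core using (Rel)
open import Relation.Nullary using (yes; no)
open import Relation.Binary.PropositionalEquality
open import Relation.Binary.Construct.Closure.ReflexiveTransitive using (ε; _◅_)
open import Relation.Binary.Construct.Closure.Transitive
  using (TransClosure; [_]) renaming (_∷_ to _∷⁺_)

-- Each linear-arithmetic contradiction below sums its hypotheses to some L ≤ R and lets
-- the ring solver show L ≡ R + 1 + k.
m≤n⇒m≢n+1+k : ∀ {m n} → m ≤ n → ∀ k → m ≢ n + suc k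
m≤n⇒m≢n+1+k {n = n} m≤n k refl = m+1+n≰m n m≤n

-- For x, y < p this says y ≡ x + k (mod p).
Shift : ℕ → ℕ → ℕ → ℕ → Set
Shift p k x y = (y ≡ x + k) ⊎ (y + p ≡ x + k)

-- For x, y < p this says q ≤ ∣ x - y ∣ ≤ p ∸ q, i.e. cyclic distance at least q.
Apart : ℕ → ℕ → ℕ → ℕ → Set
Apart p q x y = ((x + q ≤ y) ⊎ (y + q ≤ x)) × (x + q ≤ y + p) × (y + q ≤ x + p)

∣-∣-bounds⇒Apart : ∀ {p q} → q ≤ p → ∀ x y → q ≤ ∣ x - y ∣ → ∣ x - y ∣ ≤ p ∸ q → Apart p q x y
∣-∣-bounds⇒Apart {p} q≤p zero y lo hi =
  inj₁ lo , ≤-trans lo (m≤m+n y p) , m≤o∸n⇒m+n≤o y q≤p hi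
∣-∣-bounds⇒Apart {p} q≤p (suc x) zero lo hi =
  inj₂ lo , m≤o∸n⇒m+n≤o (suc x) q≤p hi , ≤-trans lo (m≤m+n (suc x) p)
∣-∣-bounds⇒Apart q≤p (suc x) (suc y) lo hi with ∣-∣-bounds⇒Apart q≤p x y lo hi
... | lower , upperˡ , upperʳ = Sum.map s≤s s≤s lower , s≤s upperˡ , s≤s upperʳ

∣m-n∣≡o⇒m≡n+o⊎n≡m+o : ∀ m n {o} → ∣ m - n ∣ ≡ o → (m ≡ n + o) ⊎ (n ≡ m + o)
∣m-n∣≡o⇒m≡n+o⊎n≡m+o zero    n       eq = inj₂ eq
∣m-n∣≡o⇒m≡n+o⊎n≡m+o (suc m) zero    eq = inj₁ eq
∣m-n∣≡o⇒m≡n+o⊎n≡m+o (suc m) (suc n) eq =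
  Sum.map (cong suc) (cong suc) (∣m-n∣≡o⇒m≡n+o⊎n≡m+o m n eq)

∣⊖∣≡∣-∣ : ∀ m n → ℤ.∣ m ⊖ n ∣ ≡ ∣ m - n ∣
∣⊖∣≡∣-∣ zero    zero    = refl
∣⊖∣≡∣-∣ zero    (suc n) = refl
∣⊖∣≡∣-∣ (suc m) zero    = refl
∣⊖∣≡∣-∣ (suc m) (suc n) = trans (cong ℤ.∣_∣ (ℤ.[1+m]⊖[1+n]≡m⊖n m n)) (∣⊖∣≡∣-∣ m n)

[y-x]-k≡y⊖[x+k] : ∀ x y k → (ℤ.+ y ℤ.- ℤ.+ x) ℤ.- ℤ.+ k ≡ y ⊖ (x + k)
[y-x]-k≡y⊖[x+k] x y k = begin
  (ℤ.+ y ℤ.- ℤ.+ x) ℤ.- ℤ.+ k       ≡⟨ ℤ.+-assoc (ℤ.+ y) (ℤ.- ℤ.+ x) (ℤ.- ℤ.+ k) ⟩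
  (ℤ.+ y) ℤ.+ (ℤ.- ℤ.+ x ℤ.- ℤ.+ k) ≡⟨ cong (ℤ._+_ (ℤ.+ y)) (ℤ.neg-distrib-+ (ℤ.+ x) (ℤ.+ k)) ⟨
  ℤ.+ y ℤ.- ℤ.+ (x + k)             ≡⟨ ℤ.m-n≡m⊖n y (x + k) ⟩
  y ⊖ (x + k)                       ∎
  where open ≡-Reasoning

∣-∣≡*⇒Shift : ∀ {p k x y} j → x < p → y < p → k ≤ p → ∣ y - (x + k) ∣ ≡ j * p → Shift p k x y
∣-∣≡*⇒Shift {p} {k} {x} {y} j x<p y<p k≤p eq with j | ∣m-n∣≡o⇒m≡n+o⊎n≡m+o y (x + k) eq
... | zero    | inj₁ y≡x+k+0 = inj₁ (trans y≡x+k+0 (+-identityʳ (x + k)))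
... | zero    | inj₂ x+k≡y+0 = inj₁ (sym (trans x+k≡y+0 (+-identityʳ y)))
... | suc j′  | inj₁ y≡x+k+[1+j′]p = ⊥-elim (m≤n⇒m≢n+1+k
      (+-mono-≤ (≤-reflexive (sym y≡x+k+[1+j′]p)) y<p) (x + k + j′ * p)
      (solve (x ∷ k ∷ j′ ∷ p ∷ y ∷ [])))
... | suc zero | inj₂ x+k≡y+1p = inj₂ (trans (cong (y +_) (sym (+-identityʳ p))) (sym x+k≡y+1p))
... | suc (suc j′) | inj₂ x+k≡y+[2+j′]p = ⊥-elim (m≤n⇒m≢n+1+k
      (+-mono-≤ (+-mono-≤ (≤-reflexive (sym x+k≡y+[2+j′]p)) x<p) k≤p) (y + j′ * p)
      (solve (x ∷ k ∷ j′ ∷ p ∷ y ∷ [])))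

∣⇒Shift : ∀ {p k x y} → x < p → y < p → k ≤ p →
  (ℤ.+ p) ∣ ((ℤ.+ y ℤ.- ℤ.+ x) ℤ.- ℤ.+ k) → Shift p k x y
∣⇒Shift {p} {k} {x} {y} x<p y<p k≤p (divides j eq) = ∣-∣≡*⇒Shift j x<p y<p k≤p (begin
  ∣ y - (x + k) ∣                          ≡⟨ ∣⊖∣≡∣-∣ y (x + k) ⟨
  ℤ.∣ y ⊖ (x + k) ∣                        ≡⟨ cong ℤ.∣_∣ ([y-x]-k≡y⊖[x+k] x y k) ⟨
  ℤ.∣ (ℤ.+ y ℤ.- ℤ.+ x) ℤ.- ℤ.+ k ∣        ≡⟨ eq ⟩
  j * p                                    ∎)
  where open ≡-Reasoning

apart-from-both⇒≡ : ∀ {p q a b c d} → 2 * q ≤ p → p < 4 * q → a < p → b < p → d < p →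
  Shift p q a b → Shift p q b c → Apart p q d a → Apart p q d c → d ≡ b
apart-from-both⇒≡ {p} {q} {a} {d = d} _ p<4q _ _ _ (inj₁ refl) (inj₁ refl)
  (inj₁ d+q≤a , _) (_ , _ , c+q≤d+p) =
  ⊥-elim (m≤n⇒m≢n+1+k (+-mono-≤ (+-mono-≤ d+q≤a c+q≤d+p) p<4q) 0 (solve (a ∷ d ∷ p ∷ q ∷ [])))
apart-from-both⇒≡ {q = q} {a} {d = d} _ _ _ _ _ (inj₁ refl) (inj₁ refl)
  (inj₂ a+q≤d , _) (inj₁ d+q≤c , _) =
  ≤-antisym (+-cancelʳ-≤ q d (a + q) d+q≤c) a+q≤d
apart-from-both⇒≡ {p} {q} {a} {d = d} _ p<4q _ _ _ (inj₁ refl) (inj₁ refl)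
  (inj₂ _ , d+q≤a+p , _) (inj₂ c+q≤d , _) =
  ⊥-elim (m≤n⇒m≢n+1+k (+-mono-≤ (+-mono-≤ c+q≤d d+q≤a+p) p<4q) 0 (solve (a ∷ d ∷ p ∷ q ∷ [])))
apart-from-both⇒≡ {p} {q} {a} {c = c} {d} _ _ _ a+q<p _ (inj₁ refl) (inj₂ c+p≡a+q+q)
  _ (inj₁ d+q≤c , _) =
  ⊥-elim (m≤n⇒m≢n+1+k (+-mono-≤ (+-mono-≤ d+q≤c (≤-reflexive c+p≡a+q+q)) a+q<p) d
    (solve (a ∷ c ∷ d ∷ p ∷ q ∷ [])))
apart-from-both⇒≡ {q = q} {a} {d = d} _ _ _ _ _ (inj₁ refl) (inj₂ c+p≡a+q+q)
  (inj₂ a+q≤d , _) (inj₂ _ , d+q≤c+p , _) =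
  ≤-antisym (+-cancelʳ-≤ q d (a + q) (≤-trans d+q≤c+p (≤-reflexive c+p≡a+q+q))) a+q≤d
apart-from-both⇒≡ {p} {q} {a} {c = c} {d} _ p<4q _ _ _ (inj₁ refl) (inj₂ c+p≡a+q+q)
  (inj₁ d+q≤a , _) (inj₂ c+q≤d , _) =
  ⊥-elim (m≤n⇒m≢n+1+k
    (+-mono-≤ (+-mono-≤ (+-mono-≤ d+q≤a c+q≤d) (≤-reflexive (sym c+p≡a+q+q))) p<4q) 0
    (solve (a ∷ c ∷ d ∷ p ∷ q ∷ [])))
apart-from-both⇒≡ {p} {q} {a} {b} {d = d} _ _ _ _ d<p (inj₂ b+p≡a+q) (inj₁ refl)
  (inj₂ a+q≤d , _) _ =
  ⊥-elim (m≤n⇒m≢n+1+k (+-mono-≤ (+-mono-≤ a+q≤d (≤-reflexive b+p≡a+q)) d<p) b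
    (solve (a ∷ b ∷ d ∷ p ∷ q ∷ [])))
apart-from-both⇒≡ {p} {q} {a} {b} {d = d} _ p<4q _ _ _ (inj₂ b+p≡a+q) (inj₁ refl)
  (inj₁ d+q≤a , _) (inj₂ c+q≤d , _) =
  ⊥-elim (m≤n⇒m≢n+1+k
    (+-mono-≤ (+-mono-≤ (+-mono-≤ d+q≤a c+q≤d) (≤-reflexive (sym b+p≡a+q))) p<4q) 0
    (solve (a ∷ b ∷ d ∷ p ∷ q ∷ [])))
apart-from-both⇒≡ {p} {q} {b = b} {d = d} _ _ _ _ _ (inj₂ b+p≡a+q) (inj₁ refl)
  (inj₁ _ , _ , a+q≤d+p) (inj₁ d+q≤c , _) =
  ≤-antisym (+-cancelʳ-≤ q d b d+q≤c) (+-cancelʳ-≤ p b d (≤-trans (≤-reflexive b+p≡a+q) a+q≤d+p))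
apart-from-both⇒≡ {p} {q} {a} {b} {c} 2q≤p _ a<p _ _ (inj₂ b+p≡a+q) (inj₂ c+p≡b+q) _ _ =
  ⊥-elim (m≤n⇒m≢n+1+k
    (+-mono-≤ (+-mono-≤ (+-mono-≤ (≤-reflexive b+p≡a+q) (≤-reflexive c+p≡b+q)) a<p) 2q≤p) c
    (solve (a ∷ b ∷ c ∷ p ∷ q ∷ [])))

module _ {a ℓ} {A : Set a} {R : Rel A ℓ} where

  head⁺ : ∀ {x y} → TransClosure R x y → ∃ (R x)
  head⁺ [ x∼y ]     = _ , x∼y
  head⁺ (x∼z ∷⁺ _) = _ , x∼z

  last⁺ : ∀ {x y} → TransClosure R x y → ∃ λ w → R w y
  last⁺ [ x∼y ]      = _ , x∼y
  last⁺ (_ ∷⁺ z∼⁺y) = last⁺ z∼⁺y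

module _ {a ℓ₁ ℓ₂} {A : Set a} {R : Rel A ℓ₁} {S : Rel A ℓ₂} where

  FlankedSubrelation : Set _
  FlankedSubrelation = ∀ {w x y z} → R w x → R x y → R y z → S x y

  map⁺-flanked : FlankedSubrelation → ∀ {w x y z} →
    R w x → TransClosure R x y → R y z → TransClosure S x y
  map⁺-flanked F w∼x [ x∼y ]        y∼z = [ F w∼x x∼y y∼z ]
  map⁺-flanked F w∼x (x∼u ∷⁺ u∼⁺y) y∼z =
    F w∼x x∼u (proj₂ (head⁺ u∼⁺y)) ∷⁺ map⁺-flanked F x∼u u∼⁺y y∼z

  map⁺-cycle : FlankedSubrelation → ∀ {v} → TransClosure R v v → TransClosure S v v
  map⁺-cycle F c = map⁺-flanked F (proj₂ (last⁺ c)) c (proj₂ (head⁺ c))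

module _ {p q : ℕ} (2q≤p : 2 * q ≤ p) (p<4q : p < 4 * q) {G : Graph} where

  q≤p : q ≤ p
  q≤p = ≤-trans (m≤m+n q (q + 0)) 2q≤p

  adj⇒≢ : ∀ {x y} → Adj G x y → x ≢ y
  adj⇒≢ x∼y refl = irrefl G x∼y

  edge⇒Apart : ∀ {g x y} → IsColouring p q G g → Adj G x y → Apart p q (g x) (g y)
  edge⇒Apart {g} {x} {y} (_ , edges) x∼y with edges x y x∼y
  ... | lo , hi = ∣-∣-bounds⇒Apart q≤p (g x) (g y) lo hi

  arc⇒Shift : ∀ {f x y} → IsColouring p q G f → Arc p q G f x y → Shift p q (f x) (f y)
  arc⇒Shift {x = x} {y} (range , _) (_ , p∣) = ∣⇒Shift (range x) (range y) q≤p p∣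

  step-fixes-middle : ∀ {f g w x y} → Step p q G f g →
    Arc p q G f w x → Arc p q G f x y → g x ≡ f x
  step-fixes-middle {f} {g} {w} {x} (f-col , g-col , u , same) w→x x→y with x ≟ᶠ u
  ... | no x≢u = sym (same x x≢u)
  ... | yes refl = apart-from-both⇒≡ 2q≤p p<4q (range w) (range x) (proj₁ g-col x)
    (arc⇒Shift f-col w→x) (arc⇒Shift f-col x→y)
    (apart-from-neighbour (Graph.sym G (proj₁ w→x))) (apart-from-neighbour (proj₁ x→y))
    where
    range = proj₁ f-col
    apart-from-neighbour : ∀ {z} → Adj G x z → Apart p q (g x) (f z)
    apart-from-neighbour {z} x∼z =
      subst (Apart p q (g x)) (sym (same z (adj⇒≢ (Graph.sym G x∼z)))) (edge⇒Apart g-col x∼z)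

  step-preserves-arc : ∀ {f g x y} → g x ≡ f x → g y ≡ f y → Arc p q G f x y → Arc p q G g x y
  step-preserves-arc gx≡fx gy≡fy arc rewrite gx≡fx | gy≡fy = arc

  step-fixes-cycle : ∀ {f g v} → Step p q G f g → OnDirectedCycle p q G f v → g v ≡ f v
  step-fixes-cycle s c = step-fixes-middle s (proj₂ (last⁺ c)) (proj₂ (head⁺ c))

  step-preserves-cycle : ∀ {f g v} → Step p q G f g →
    OnDirectedCycle p q G f v → OnDirectedCycle p q G g v
  step-preserves-cycle s = map⁺-cycle λ w→x x→y y→z →
    step-preserves-arc (step-fixes-middle s w→x x→y) (step-fixes-middle s x→y y→z) x→y

  reconfiguration-fixes-cycle : ∀ {f h v} → OnDirectedCycle p q G f v →
    Reconfigures p q G f h → h v ≡ f v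
  reconfiguration-fixes-cycle c ε          = refl
  reconfiguration-fixes-cycle c (s ◅ rest) =
    trans (reconfiguration-fixes-cycle (step-preserves-cycle s c) rest) (step-fixes-cycle s c)

lemma2p8 : (p q : ℕ) → 1 ≤ q → 2 * q ≤ p → p < 4 * q →
    (G : Graph) (f : Colouring G) → IsColouring p q G f →
    (v : Fin (n G)) → OnDirectedCycle p q G f v →
    (h : Colouring G) → IsColouring p q G h → Reconfigures p q G f h →
    h v ≡ f v
lemma2p8 _ _ _ 2q≤p p<4q G _ _ _ c _ _ f⇝h = reconfiguration-fixes-cycle 2q≤p p<4q {G} c f⇝h
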